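{- Let $D$ be a finite or infinite digraph. All point-bases of $D$ have the same cardinality, and all arc-bases of $D$ have the same cardinality.
   Context: $D$ is a digraph with vertex set $X(D)$ (arcs are ordered pairs of distinct vertices), possibly infinite. $v$ is reachable from $u$ if there is a directed path (possibly of length $0$) from $u$ to $v$. A point-reaching set is $S\subseteq X(D)$ such that every vertex is reachable from some vertex of $S$; a point-basis is an inclusion-minimal point-reaching set. An arc-reaching set is $S\subseteq X(D)$ such that for every arc $(u,v)$, $u$ is reachable from some vertex of $S$; an arc-basis is an inclusion-minimal arc-reaching set. -}

module Defs where

open import Data.Bool using (Bool; true)
open import Data.Product using (Σ; ∃; _×_)
open import Relation.Nullary using (¬_)
open import Relation.Binary.PropositionalEquality using (_≡_)
open import Relation.Binary.Construct.Closure.ReflexiveTransitive using (Star)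
open import Function.Bundles using (_↔_)

record Digraph : Set₁ where
  field
    X      : Set
    Arc    : X → X → Set
    noLoop : ∀ {u} → ¬ Arc u u
open Digraph public

-- Subsets of the vertex set (classically every subset is Bool-valued).
VSet : Digraph → Set
VSet D = X D → Bool

_⊆_ : ∀ {D} → VSet D → VSet D → Set
_⊆_ {D} S T = ∀ (v : X D) → S v ≡ true → T v ≡ true

Reachable : (D : Digraph) → X D → X D → Set
Reachable D = Star (Arc D)

PointReaching : (D : Digraph) → VSet D → Set
PointReaching D S = ∀ (v : X D) → ∃ λ s → (S s ≡ true) × Reachable D s v

ArcReaching : (D : Digraph) → VSet D → Set
ArcReaching D S = ∀ (u v : X D) → Arc D u v → ∃ λ s → (S s ≡ true) × Reachable D s u

Minimal : (D : Digraph) → (VSet D → Set) → VSet D → Set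
Minimal D P S = P S × (∀ (S' : VSet D) → _⊆_ {D} S' S → P S' → _⊆_ {D} S S')

PointBasis : (D : Digraph) → VSet D → Set
PointBasis D = Minimal D (PointReaching D)

ArcBasis : (D : Digraph) → VSet D → Set
ArcBasis D = Minimal D (ArcReaching D)

Elems : (D : Digraph) → VSet D → Set
Elems D S = Σ (X D) (λ v → S v ≡ true)

SameCard : (D : Digraph) → VSet D → VSet D → Set
SameCard D S T = Elems D S ↔ Elems D T

-- Fix a set of "targets" closed under predecessors (every vertex from which a
-- target is reachable is a target); point-bases and arc-bases are the minimal
-- sets reaching all targets, for the targets "all vertices" and "all tails of
-- arcs". In a minimal such set S each s ∈ S has a private target, reached from
-- no other element of S. Hence no element of S reaches another, and s itself is
-- a target, so it is reached from every other reaching set T. Sending s to some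
-- t ∈ T reaching it, and t back to some s' ∈ S reaching t, gives s' reaching s,
-- so s' = s: for two minimal sets these maps are mutually inverse.
module Submission where

open import Defs
open import Axiom.ExcludedMiddle using (ExcludedMiddle)
open import Axiom.DoubleNegationElimination using (em⇒dne)
import Axiom.UniquenessOfIdentityProofs as UIP
open import Level using (0ℓ)
open import Data.Bool using (false; true)
import Data.Bool as Bool
open import Data.Unit using (⊤; tt)
open import Data.Product using (∃; _×_; _,_; proj₁; proj₂)
open import Function.Bundles using (_⇔_; mk⇔; mk↔ₛ′; Equivalence)
open import Relation.Nullary using (¬_; yes; no; contradiction)
open import Relation.Binary.PropositionalEquality using (_≡_; refl; cong)
open import Relation.Binary.Construct.Closure.ReflexiveTransitive using (ε; _◅_; _◅◅_)

Minimal-resp-⇔ : ∀ {D P Q} → (∀ S → P S ⇔ Q S) → ∀ {S} → Minimal D P S → Minimal D Q S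
Minimal-resp-⇔ P⇔Q {S} (PS , minimal) =
  Equivalence.to (P⇔Q S) PS ,
  λ S' S'⊆S QS' → minimal S' S'⊆S (Equivalence.from (P⇔Q S') QS')

∈-irrelevant : ∀ D (S : VSet D) {v} (p q : S v ≡ true) → p ≡ q
∈-irrelevant D S = UIP.Decidable⇒UIP.≡-irrelevant Bool._≟_

Elems-≡ : ∀ D (S : VSet D) {v w} (p : S v ≡ true) (q : S w ≡ true) →
          v ≡ w → _≡_ {A = Elems D S} (v , p) (w , q)
Elems-≡ D S p q refl = cong (_ ,_) (∈-irrelevant D S p q)

module Bases (em : ExcludedMiddle 0ℓ) (D : Digraph) where

  dne : {P : Set} → ¬ ¬ P → P
  dne = em⇒dne em

  remove : VSet D → X D → VSet D
  remove S s v with em {v ≡ s}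
  ... | yes _ = false
  ... | no  _ = S v

  remove-⊆ : ∀ S s → _⊆_ {D} (remove S s) S
  remove-⊆ S s v with em {v ≡ s}
  ... | yes _ = λ ()
  ... | no  _ = λ v∈S → v∈S

  ∈-remove : ∀ S {s v} → S v ≡ true → ¬ v ≡ s → remove S s v ≡ true
  ∈-remove S {s} {v} v∈S v≢s with em {v ≡ s}
  ... | yes v≡s = contradiction v≡s v≢s
  ... | no _ = v∈S

  ∉-remove : ∀ S s → ¬ remove S s s ≡ true
  ∉-remove S s with em {s ≡ s}
  ... | yes _   = λ ()
  ... | no s≢s = λ _ → s≢s refl

  module Targets (Target : X D → Set)
                 (Target-closed : ∀ {x y} → Reachable D x y → Target y → Target x) where

    Covers : VSet D → Set
    Covers S = ∀ x → Target x → ∃ λ s → (S s ≡ true) × Reachable D s x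

    Basis : VSet D → Set
    Basis = Minimal D Covers

    PrivateTarget : VSet D → X D → X D → Set
    PrivateTarget S s x =
      Target x × Reachable D s x × (∀ {s'} → S s' ≡ true → Reachable D s' x → s' ≡ s)

    Basis⇒¬Covers-remove : ∀ {S s} → Basis S → S s ≡ true → ¬ Covers (remove S s)
    Basis⇒¬Covers-remove {S} {s} (_ , minimal) s∈S covers =
      ∉-remove S s (minimal (remove S s) (remove-⊆ S s) covers s s∈S)

    privateTarget : ∀ {S s} → Basis S → S s ≡ true → ∃ (PrivateTarget S s)
    privateTarget {S} {s} basis@(covers , _) s∈S = x , Tx , reach , only-s
      where
      uncovered : ∃ λ x → Target x × ¬ (∃ λ s' → (remove S s s' ≡ true) × Reachable D s' x)
      uncovered = dne λ ¬uncovered → Basis⇒¬Covers-remove basis s∈S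
        λ x Tx → dne λ ¬reached → ¬uncovered (x , Tx , ¬reached)

      x = proj₁ uncovered
      Tx = proj₁ (proj₂ uncovered)

      only-s : ∀ {s'} → S s' ≡ true → Reachable D s' x → s' ≡ s
      only-s s'∈S s'↝x = dne λ s'≢s → proj₂ (proj₂ uncovered) (_ , ∈-remove S s'∈S s'≢s , s'↝x)

      reach : Reachable D s x
      reach with covers x Tx
      ... | s' , s'∈S , s'↝x with only-s s'∈S s'↝x
      ... | refl = s'↝x

    Basis-antichain : ∀ {S s s'} → Basis S → S s ≡ true → S s' ≡ true →
                      Reachable D s' s → s' ≡ s
    Basis-antichain basis s∈S s'∈S s'↝s with privateTarget basis s∈S
    ... | _ , _ , s↝x , only-s = only-s s'∈S (s'↝s ◅◅ s↝x)

    Basis⇒Target : ∀ {S s} → Basis S → S s ≡ true → Target s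
    Basis⇒Target basis s∈S with privateTarget basis s∈S
    ... | _ , Tx , s↝x , _ = Target-closed s↝x Tx

    reachedFrom : ∀ {S T} → Basis S → Covers T → (s : Elems D S) →
                  ∃ λ t → (T t ≡ true) × Reachable D t (proj₁ s)
    reachedFrom basisS coversT (s , s∈S) = coversT s (Basis⇒Target basisS s∈S)

    coverOf : ∀ {S T} → Basis S → Covers T → Elems D S → Elems D T
    coverOf basisS coversT s with reachedFrom basisS coversT s
    ... | t , t∈T , _ = t , t∈T

    coverOf∘coverOf : ∀ {S T} (basisS : Basis S) (basisT : Basis T) (s : Elems D S) →
                      coverOf basisT (proj₁ basisS) (coverOf basisS (proj₁ basisT) s) ≡ s
    coverOf∘coverOf {S} basisS basisT (s , s∈S) with reachedFrom basisS (proj₁ basisT) (s , s∈S)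
    ... | t , t∈T , t↝s with reachedFrom basisT (proj₁ basisS) (t , t∈T)
    ... | s' , s'∈S , s'↝t =
      Elems-≡ D S s'∈S s∈S (Basis-antichain basisS s∈S s'∈S (s'↝t ◅◅ t↝s))

    Basis-sameCard : ∀ {S T} → Basis S → Basis T → SameCard D S T
    Basis-sameCard basisS basisT =
      mk↔ₛ′ (coverOf basisS (proj₁ basisT)) (coverOf basisT (proj₁ basisS))
            (coverOf∘coverOf basisT basisS) (coverOf∘coverOf basisS basisT)

corollary17 : ExcludedMiddle 0ℓ → (D : Digraph) →
    ((S T : VSet D) → PointBasis D S → PointBasis D T → SameCard D S T)
    × ((S T : VSet D) → ArcBasis D S → ArcBasis D T → SameCard D S T)
corollary17 em D =
  (λ S T basisS basisT → Points.Basis-sameCard (pointBasis basisS) (pointBasis basisT)) ,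
  (λ S T basisS basisT → Tails.Basis-sameCard (arcBasis basisS) (arcBasis basisT))
  where
  open Bases em D

  Tail : X D → Set
  Tail u = ∃ (Arc D u)

  Tail-closed : ∀ {x y} → Reachable D x y → Tail y → Tail x
  Tail-closed ε        tail = tail
  Tail-closed (a ◅ _) _    = _ , a

  module Points = Targets (λ _ → ⊤) (λ _ _ → tt)
  module Tails  = Targets Tail Tail-closed

  points⇔ : ∀ S → PointReaching D S ⇔ Points.Covers S
  points⇔ S = mk⇔ (λ reaching x _ → reaching x) (λ covers x → covers x tt)

  tails⇔ : ∀ S → ArcReaching D S ⇔ Tails.Covers S
  tails⇔ S = mk⇔ (λ reaching u (v , a) → reaching u v a) (λ covers u v a → covers u (v , a))

  pointBasis : ∀ {S} → PointBasis D S → Points.Basis S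
  pointBasis = Minimal-resp-⇔ {D} {PointReaching D} points⇔

  arcBasis : ∀ {S} → ArcBasis D S → Tails.Basis S
  arcBasis = Minimal-resp-⇔ {D} {ArcReaching D} tails⇔
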